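{- A cd-category $\mathcal{C}$ has normalisation if and only if every morphism $f$ has a minimal normalisation $m(f)$ and these satisfy $m(f\otimes g)=m(f)\otimes m(g)$ for all morphisms $f,g$, and $m(f\circ\Delta_X)=m(f)\circ\Delta_X$ for all $f\colon X\otimes X\to Y$.
   Context: A cd-category is a symmetric monoidal category $(\mathcal{C},\otimes,I)$ in which every object $X$ carries $\Delta_X\colon X\to X\otimes X$ and $\epsilon_X\colon X\to I$ forming a commutative comonoid, compatible with the tensor. For $f,g\colon X\to Y$, $g$ normalises $f$ if $f=(g\otimes(\epsilon_Y\circ f))\circ\Delta_X$; $g$ is a partial channel if it normalises itself. A minimal normalisation of $f$ is a partial channel $f'$ that normalises $f$ and such that every partial channel normalising $f$ also normalises $f'$. $\mathcal{C}$ has normalisation if there is an assignment to each $f\colon X\to Y$ of a partial channel $\mathrm{norm}(f)\colon X\to Y$ that normalises $f$, such that (N1) $\mathrm{norm}(f)=f$ when $f$ is a partial channel; (N2) $\mathrm{norm}(f\otimes g)=\mathrm{norm}(f)\otimes\mathrm{norm}(g)$; (N3) $\mathrm{norm}(\epsilon_Y\circ f)=\epsilon_Y\circ\mathrm{norm}(f)$; (N4) $\mathrm{norm}(f\circ\Delta_X)=\mathrm{norm}(f)\circ\Delta_X$ for all $f\colon X\otimes X\to Y$. -}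

module Defs where

open import Level using (Level; _⊔_) renaming (suc to lsuc)
open import Data.Product using (Σ; _×_)
open import Relation.Binary.PropositionalEquality using (_≡_)

record CDCategory (o ℓ : Level) : Set (lsuc (o ⊔ ℓ)) where
  infixr 9 _∘_
  infixr 10 _⊗₀_ _⊗₁_
  field
    Obj : Set o
    _⇒_ : Obj → Obj → Set ℓ
    id  : ∀ {A} → A ⇒ A
    _∘_ : ∀ {A B C} → B ⇒ C → A ⇒ B → A ⇒ C
    assoc     : ∀ {A B C D} {f : A ⇒ B} {g : B ⇒ C} {h : C ⇒ D} →
                (h ∘ g) ∘ f ≡ h ∘ (g ∘ f)
    identityˡ : ∀ {A B} {f : A ⇒ B} → id ∘ f ≡ f
    identityʳ : ∀ {A B} {f : A ⇒ B} → f ∘ id ≡ f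

    _⊗₀_ : Obj → Obj → Obj
    _⊗₁_ : ∀ {A B C D} → A ⇒ B → C ⇒ D → (A ⊗₀ C) ⇒ (B ⊗₀ D)
    ⊗-id : ∀ {A B} → id {A} ⊗₁ id {B} ≡ id
    ⊗-∘  : ∀ {A B C D E F} {f : A ⇒ B} {f' : B ⇒ C} {g : D ⇒ E} {g' : E ⇒ F} →
           (f' ∘ f) ⊗₁ (g' ∘ g) ≡ (f' ⊗₁ g') ∘ (f ⊗₁ g)
    unit : Obj

    α⇒ : ∀ {A B C} → ((A ⊗₀ B) ⊗₀ C) ⇒ (A ⊗₀ (B ⊗₀ C))
    α⇐ : ∀ {A B C} → (A ⊗₀ (B ⊗₀ C)) ⇒ ((A ⊗₀ B) ⊗₀ C)
    λ⇒ : ∀ {A} → (unit ⊗₀ A) ⇒ A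
    λ⇐ : ∀ {A} → A ⇒ (unit ⊗₀ A)
    ρ⇒ : ∀ {A} → (A ⊗₀ unit) ⇒ A
    ρ⇐ : ∀ {A} → A ⇒ (A ⊗₀ unit)
    σ  : ∀ {A B} → (A ⊗₀ B) ⇒ (B ⊗₀ A)

    α-isoˡ : ∀ {A B C} → α⇐ {A} {B} {C} ∘ α⇒ ≡ id
    α-isoʳ : ∀ {A B C} → α⇒ {A} {B} {C} ∘ α⇐ ≡ id
    λ-isoˡ : ∀ {A} → λ⇐ {A} ∘ λ⇒ ≡ id
    λ-isoʳ : ∀ {A} → λ⇒ {A} ∘ λ⇐ ≡ id
    ρ-isoˡ : ∀ {A} → ρ⇐ {A} ∘ ρ⇒ ≡ id
    ρ-isoʳ : ∀ {A} → ρ⇒ {A} ∘ ρ⇐ ≡ id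
    σ-inv  : ∀ {A B} → σ {B} {A} ∘ σ {A} {B} ≡ id

    α-natural : ∀ {A B C D E F} {f : A ⇒ B} {g : C ⇒ D} {h : E ⇒ F} →
                α⇒ ∘ ((f ⊗₁ g) ⊗₁ h) ≡ (f ⊗₁ (g ⊗₁ h)) ∘ α⇒
    λ-natural : ∀ {A B} {f : A ⇒ B} → λ⇒ ∘ (id ⊗₁ f) ≡ f ∘ λ⇒
    ρ-natural : ∀ {A B} {f : A ⇒ B} → ρ⇒ ∘ (f ⊗₁ id) ≡ f ∘ ρ⇒
    σ-natural : ∀ {A B C D} {f : A ⇒ B} {g : C ⇒ D} →
                σ ∘ (f ⊗₁ g) ≡ (g ⊗₁ f) ∘ σ

    triangle : ∀ {A B} → (id {A} ⊗₁ λ⇒ {B}) ∘ α⇒ ≡ ρ⇒ ⊗₁ id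
    pentagon : ∀ {A B C D} →
               (id {A} ⊗₁ α⇒ {B} {C} {D}) ∘ (α⇒ ∘ (α⇒ ⊗₁ id)) ≡ α⇒ ∘ α⇒
    hexagon  : ∀ {A B C} →
               α⇒ {B} {C} {A} ∘ (σ ∘ α⇒) ≡ (id ⊗₁ σ) ∘ (α⇒ ∘ (σ ⊗₁ id))

    Δ : ∀ {A} → A ⇒ (A ⊗₀ A)
    ε : ∀ {A} → A ⇒ unit
    counitˡ : ∀ {A} → λ⇒ ∘ ((ε ⊗₁ id) ∘ Δ {A}) ≡ id
    counitʳ : ∀ {A} → ρ⇒ ∘ ((id ⊗₁ ε) ∘ Δ {A}) ≡ id
    coassoc : ∀ {A} → α⇒ ∘ ((Δ ⊗₁ id) ∘ Δ {A}) ≡ (id ⊗₁ Δ) ∘ Δ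
    cocomm  : ∀ {A} → σ ∘ Δ {A} ≡ Δ

    ε-⊗    : ∀ {A B} → ε {A ⊗₀ B} ≡ λ⇒ ∘ (ε ⊗₁ ε)
    ε-unit : ε {unit} ≡ id
    Δ-⊗    : ∀ {A B} → Δ {A ⊗₀ B} ≡
             (α⇐ ∘ ((id ⊗₁ (α⇒ ∘ ((σ ⊗₁ id) ∘ α⇐))) ∘ α⇒)) ∘ (Δ ⊗₁ Δ)
    Δ-unit : Δ {unit} ≡ λ⇐

module _ {o ℓ : Level} (C : CDCategory o ℓ) where
  open CDCategory C

  Normalises : ∀ {X Y} → X ⇒ Y → X ⇒ Y → Set ℓ
  Normalises g f = f ≡ ρ⇒ ∘ ((g ⊗₁ (ε ∘ f)) ∘ Δ)

  PartialChannel : ∀ {X Y} → X ⇒ Y → Set ℓ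
  PartialChannel g = Normalises g g

  IsMinimalNormalisation : ∀ {X Y} → X ⇒ Y → X ⇒ Y → Set ℓ
  IsMinimalNormalisation {X} {Y} f f' =
    PartialChannel f' × Normalises f' f ×
    (∀ (g : X ⇒ Y) → PartialChannel g → Normalises g f → Normalises g f')

  record HasNormalisation : Set (o ⊔ ℓ) where
    field
      norm : ∀ {X Y} → X ⇒ Y → X ⇒ Y
      norm-partial    : ∀ {X Y} (f : X ⇒ Y) → PartialChannel (norm f)
      norm-normalises : ∀ {X Y} (f : X ⇒ Y) → Normalises (norm f) f
      N1 : ∀ {X Y} (f : X ⇒ Y) → PartialChannel f → norm f ≡ f
      N2 : ∀ {X Y Z W} (f : X ⇒ Y) (g : Z ⇒ W) → norm (f ⊗₁ g) ≡ norm f ⊗₁ norm g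
      N3 : ∀ {X Y} (f : X ⇒ Y) → norm (ε ∘ f) ≡ ε ∘ norm f
      N4 : ∀ {X Y} (f : (X ⊗₀ X) ⇒ Y) → norm (f ∘ Δ) ≡ norm f ∘ Δ

  HasCompatibleMinimalNormalisations : Set (o ⊔ ℓ)
  HasCompatibleMinimalNormalisations =
    Σ (∀ {X Y} → X ⇒ Y → X ⇒ Y) λ m →
      (∀ {X Y} (f : X ⇒ Y) → IsMinimalNormalisation f (m f)) ×
      (∀ {X Y Z W} (f : X ⇒ Y) (g : Z ⇒ W) → m (f ⊗₁ g) ≡ m f ⊗₁ m g) ×
      (∀ {X Y} (f : (X ⊗₀ X) ⇒ Y) → m (f ∘ Δ) ≡ m f ∘ Δ)

-- Write g · a for ρ⇒ ∘ (g ⊗ a) ∘ Δ, so that "g normalises f" reads f ≡ g · (ε ∘ f).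
-- The scalars X ⇒ I commute under ·, and ε ∘ (g · a) ≡ (ε ∘ g) · a; from these,
-- two morphisms that normalise each other, one of them a partial channel, are equal.
-- Any m preserving ⊗, Δ and ε commutes with ρ⇐ ≡ (id ⊗ ε) ∘ Δ, hence carries
-- f ≡ g · (ε ∘ f) to m f ≡ m g · m (ε ∘ f).  For norm this is exactly minimality
-- (using N1 for g and N3); conversely minimal normalisations satisfy N1 and N3 by
-- antisymmetry, the second because ε ∘ m f and m (ε ∘ f) normalise each other.
module Submission where

open import Defs
open import Level using (Level)
open import Function.Bundles using (_⇔_; mk⇔)
open import Data.Product using (_,_; proj₁; proj₂)
open import Relation.Binary.PropositionalEquality
open ≡-Reasoning

module Normalisation {o ℓ : Level} (C : CDCategory o ℓ) where
  open CDCategory C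

  infixl 8 _·_

  _·_ : ∀ {X Y} → X ⇒ Y → X ⇒ unit → X ⇒ Y
  g · a = ρ⇒ ∘ ((g ⊗₁ a) ∘ Δ)

  ρ-cancelʳ : ∀ {A B} (h : A ⇒ B) → ρ⇒ ∘ (ρ⇐ ∘ h) ≡ h
  ρ-cancelʳ h = trans (sym assoc) (trans (cong (_∘ h) ρ-isoʳ) identityˡ)

  ρ-cancelˡ : ∀ {A B} (h : A ⇒ (B ⊗₀ unit)) → ρ⇐ ∘ (ρ⇒ ∘ h) ≡ h
  ρ-cancelˡ h = trans (sym assoc) (trans (cong (_∘ h) ρ-isoˡ) identityˡ)

  ⊗-split : ∀ {A B C D} (f : A ⇒ B) (g : C ⇒ D) → f ⊗₁ g ≡ (f ⊗₁ id) ∘ (id ⊗₁ g)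
  ⊗-split f g = trans (cong₂ _⊗₁_ (sym identityʳ) (sym identityˡ)) ⊗-∘

  ρ⇐-counit : ∀ {A} → ρ⇐ {A} ≡ (id ⊗₁ ε) ∘ Δ
  ρ⇐-counit = trans (sym identityʳ) (trans (cong (ρ⇐ ∘_) (sym counitʳ)) (ρ-cancelˡ _))

  ρ⇐-natural : ∀ {A B} (f : A ⇒ B) → ρ⇐ ∘ f ≡ (f ⊗₁ id) ∘ ρ⇐
  ρ⇐-natural f = begin
    ρ⇐ ∘ f                          ≡⟨ cong (ρ⇐ ∘_) (sym identityʳ) ⟩
    ρ⇐ ∘ (f ∘ id)                   ≡⟨ cong (λ z → ρ⇐ ∘ (f ∘ z)) (sym ρ-isoʳ) ⟩
    ρ⇐ ∘ (f ∘ (ρ⇒ ∘ ρ⇐))            ≡⟨ cong (ρ⇐ ∘_) (sym assoc) ⟩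
    ρ⇐ ∘ ((f ∘ ρ⇒) ∘ ρ⇐)            ≡⟨ cong (λ z → ρ⇐ ∘ (z ∘ ρ⇐)) (sym ρ-natural) ⟩
    ρ⇐ ∘ ((ρ⇒ ∘ (f ⊗₁ id)) ∘ ρ⇐)    ≡⟨ cong (ρ⇐ ∘_) assoc ⟩
    ρ⇐ ∘ (ρ⇒ ∘ ((f ⊗₁ id) ∘ ρ⇐))    ≡⟨ ρ-cancelˡ _ ⟩
    (f ⊗₁ id) ∘ ρ⇐                  ∎

  ρ⇐-copy-discard : ∀ {A B} (f : A ⇒ B) → ρ⇐ ∘ f ≡ (f ⊗₁ ε) ∘ Δ
  ρ⇐-copy-discard f = begin
    ρ⇐ ∘ f                       ≡⟨ ρ⇐-natural f ⟩
    (f ⊗₁ id) ∘ ρ⇐               ≡⟨ cong ((f ⊗₁ id) ∘_) ρ⇐-counit ⟩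
    (f ⊗₁ id) ∘ ((id ⊗₁ ε) ∘ Δ)  ≡⟨ sym assoc ⟩
    ((f ⊗₁ id) ∘ (id ⊗₁ ε)) ∘ Δ  ≡⟨ cong (_∘ Δ) (sym (⊗-split f ε)) ⟩
    (f ⊗₁ ε) ∘ Δ                 ∎

  ε∘-scalar : ∀ {X} (a : X ⇒ unit) → ε ∘ a ≡ a
  ε∘-scalar a = trans (cong (_∘ a) ε-unit) identityˡ

  ε-partialChannel : ∀ {X} → PartialChannel C (ε {X})
  ε-partialChannel = sym (begin
    ε · (ε ∘ ε)                          ≡⟨ cong (ε ·_) (ε∘-scalar ε) ⟩
    ρ⇒ ∘ ((ε ⊗₁ ε) ∘ Δ)                  ≡⟨ cong (ρ⇒ ∘_) (sym (ρ⇐-copy-discard ε)) ⟩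
    ρ⇒ ∘ (ρ⇐ ∘ ε)                        ≡⟨ ρ-cancelʳ ε ⟩
    ε                                    ∎)

  ε∘-· : ∀ {X Y} (g : X ⇒ Y) (a : X ⇒ unit) → ε ∘ (g · a) ≡ (ε ∘ g) · a
  ε∘-· g a = begin
    ε ∘ (ρ⇒ ∘ ((g ⊗₁ a) ∘ Δ))            ≡⟨ sym assoc ⟩
    (ε ∘ ρ⇒) ∘ ((g ⊗₁ a) ∘ Δ)            ≡⟨ cong (_∘ ((g ⊗₁ a) ∘ Δ)) (sym ρ-natural) ⟩
    (ρ⇒ ∘ (ε ⊗₁ id)) ∘ ((g ⊗₁ a) ∘ Δ)    ≡⟨ assoc ⟩
    ρ⇒ ∘ ((ε ⊗₁ id) ∘ ((g ⊗₁ a) ∘ Δ))    ≡⟨ cong (ρ⇒ ∘_) (sym assoc) ⟩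
    ρ⇒ ∘ (((ε ⊗₁ id) ∘ (g ⊗₁ a)) ∘ Δ)    ≡⟨ cong (λ z → ρ⇒ ∘ (z ∘ Δ)) (sym ⊗-∘) ⟩
    ρ⇒ ∘ (((ε ∘ g) ⊗₁ (id ∘ a)) ∘ Δ)     ≡⟨ cong (λ z → ρ⇒ ∘ (((ε ∘ g) ⊗₁ z) ∘ Δ)) identityˡ ⟩
    (ε ∘ g) · a                          ∎

  σ-unit : σ {unit} {unit} ≡ id
  σ-unit = begin
    σ                  ≡⟨ sym identityʳ ⟩
    σ ∘ id             ≡⟨ cong (σ ∘_) (sym λ-isoˡ) ⟩
    σ ∘ (λ⇐ ∘ λ⇒)      ≡⟨ sym assoc ⟩
    (σ ∘ λ⇐) ∘ λ⇒      ≡⟨ cong (λ z → (σ ∘ z) ∘ λ⇒) (sym Δ-unit) ⟩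
    (σ ∘ Δ) ∘ λ⇒       ≡⟨ cong (_∘ λ⇒) (trans cocomm Δ-unit) ⟩
    λ⇐ ∘ λ⇒            ≡⟨ λ-isoˡ ⟩
    id                 ∎

  ·-comm : ∀ {X} (a b : X ⇒ unit) → a · b ≡ b · a
  ·-comm a b = sym (begin
    ρ⇒ ∘ ((b ⊗₁ a) ∘ Δ)            ≡⟨ cong (λ z → ρ⇒ ∘ ((b ⊗₁ a) ∘ z)) (sym cocomm) ⟩
    ρ⇒ ∘ ((b ⊗₁ a) ∘ (σ ∘ Δ))      ≡⟨ cong (ρ⇒ ∘_) (sym assoc) ⟩
    ρ⇒ ∘ (((b ⊗₁ a) ∘ σ) ∘ Δ)      ≡⟨ cong (λ z → ρ⇒ ∘ (z ∘ Δ)) (sym σ-natural) ⟩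
    ρ⇒ ∘ ((σ ∘ (a ⊗₁ b)) ∘ Δ)      ≡⟨ cong (ρ⇒ ∘_) assoc ⟩
    ρ⇒ ∘ (σ ∘ ((a ⊗₁ b) ∘ Δ))      ≡⟨ cong (λ z → ρ⇒ ∘ (z ∘ ((a ⊗₁ b) ∘ Δ))) σ-unit ⟩
    ρ⇒ ∘ (id ∘ ((a ⊗₁ b) ∘ Δ))     ≡⟨ cong (ρ⇒ ∘_) identityˡ ⟩
    a · b                          ∎)

  ε∘-normalises : ∀ {X Y} {g f : X ⇒ Y} → Normalises C g f → Normalises C (ε ∘ g) (ε ∘ f)
  ε∘-normalises {g = g} {f} g-f = begin
    ε ∘ f                    ≡⟨ cong (ε ∘_) g-f ⟩
    ε ∘ (g · (ε ∘ f))        ≡⟨ ε∘-· g (ε ∘ f) ⟩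
    (ε ∘ g) · (ε ∘ f)        ≡⟨ cong ((ε ∘ g) ·_) (sym (ε∘-scalar (ε ∘ f))) ⟩
    (ε ∘ g) · (ε ∘ (ε ∘ f))  ∎

  ε∘-partialChannel : ∀ {X Y} {g : X ⇒ Y} → PartialChannel C g → PartialChannel C (ε ∘ g)
  ε∘-partialChannel = ε∘-normalises

  normalises-antisym : ∀ {X Y} {p q : X ⇒ Y} → PartialChannel C q →
                       Normalises C q p → Normalises C p q → p ≡ q
  normalises-antisym {p = p} {q} q-q q-p p-q = begin
    p              ≡⟨ q-p ⟩
    q · (ε ∘ p)    ≡⟨ cong (q ·_) same-discard ⟩
    q · (ε ∘ q)    ≡⟨ sym q-q ⟩
    q              ∎
    where
    same-discard : ε ∘ p ≡ ε ∘ q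
    same-discard = begin
      ε ∘ p                ≡⟨ cong (ε ∘_) q-p ⟩
      ε ∘ (q · (ε ∘ p))    ≡⟨ ε∘-· q (ε ∘ p) ⟩
      (ε ∘ q) · (ε ∘ p)    ≡⟨ ·-comm (ε ∘ q) (ε ∘ p) ⟩
      (ε ∘ p) · (ε ∘ q)    ≡⟨ sym (ε∘-· p (ε ∘ q)) ⟩
      ε ∘ (p · (ε ∘ q))    ≡⟨ cong (ε ∘_) (sym p-q) ⟩
      ε ∘ q                ∎

  module Compatible
    (m : ∀ {X Y} → X ⇒ Y → X ⇒ Y)
    (m-⊗ : ∀ {X Y Z W} (f : X ⇒ Y) (g : Z ⇒ W) → m (f ⊗₁ g) ≡ m f ⊗₁ m g)
    (m-Δ : ∀ {X Y} (f : (X ⊗₀ X) ⇒ Y) → m (f ∘ Δ) ≡ m f ∘ Δ)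
    (m-ε : ∀ {X} → m (ε {X}) ≡ ε)
    where

    m-ρ⇐ : ∀ {A B} (h : A ⇒ B) → m (ρ⇐ ∘ h) ≡ ρ⇐ ∘ m h
    m-ρ⇐ h = begin
      m (ρ⇐ ∘ h)          ≡⟨ cong m (ρ⇐-copy-discard h) ⟩
      m ((h ⊗₁ ε) ∘ Δ)    ≡⟨ m-Δ _ ⟩
      m (h ⊗₁ ε) ∘ Δ      ≡⟨ cong (_∘ Δ) (m-⊗ h ε) ⟩
      (m h ⊗₁ m ε) ∘ Δ    ≡⟨ cong (λ z → (m h ⊗₁ z) ∘ Δ) m-ε ⟩
      (m h ⊗₁ ε) ∘ Δ      ≡⟨ sym (ρ⇐-copy-discard (m h)) ⟩
      ρ⇐ ∘ m h            ∎

    m-normalises : ∀ {X Y} {g f : X ⇒ Y} → m g ≡ g → Normalises C g f → m f ≡ g · m (ε ∘ f)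
    m-normalises {g = g} {f} m-g g-f = begin
      m f                                        ≡⟨ sym (ρ-cancelʳ (m f)) ⟩
      ρ⇒ ∘ (ρ⇐ ∘ m f)                            ≡⟨ cong (ρ⇒ ∘_) (sym (m-ρ⇐ f)) ⟩
      ρ⇒ ∘ m (ρ⇐ ∘ f)                            ≡⟨ cong (λ z → ρ⇒ ∘ m (ρ⇐ ∘ z)) g-f ⟩
      ρ⇒ ∘ m (ρ⇐ ∘ (ρ⇒ ∘ ((g ⊗₁ (ε ∘ f)) ∘ Δ)))  ≡⟨ cong (λ z → ρ⇒ ∘ m z) (ρ-cancelˡ _) ⟩
      ρ⇒ ∘ m ((g ⊗₁ (ε ∘ f)) ∘ Δ)                ≡⟨ cong (ρ⇒ ∘_) (m-Δ _) ⟩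
      ρ⇒ ∘ (m (g ⊗₁ (ε ∘ f)) ∘ Δ)                ≡⟨ cong (λ z → ρ⇒ ∘ (z ∘ Δ)) (m-⊗ g (ε ∘ f)) ⟩
      ρ⇒ ∘ ((m g ⊗₁ m (ε ∘ f)) ∘ Δ)              ≡⟨ cong (λ z → z · m (ε ∘ f)) m-g ⟩
      g · m (ε ∘ f)                              ∎

  normalisation⇒compatibleMinimal : HasNormalisation C → HasCompatibleMinimalNormalisations C
  normalisation⇒compatibleMinimal n =
    norm , (λ f → norm-partial f , norm-normalises f , norm-minimal f) , N2 , N4
    where
    open HasNormalisation n
    open Compatible norm N2 N4 (N1 ε ε-partialChannel)

    norm-minimal : ∀ {X Y} (f g : X ⇒ Y) → PartialChannel C g →
                   Normalises C g f → Normalises C g (norm f)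
    norm-minimal f g g-g g-f =
      trans (m-normalises (N1 g g-g) g-f) (cong (g ·_) (N3 f))

  module Minimal
    (m : ∀ {X Y} → X ⇒ Y → X ⇒ Y)
    (m-minimal : ∀ {X Y} (f : X ⇒ Y) → IsMinimalNormalisation C f (m f))
    where

    m-partial : ∀ {X Y} (f : X ⇒ Y) → PartialChannel C (m f)
    m-partial f = proj₁ (m-minimal f)

    m-normalises-f : ∀ {X Y} (f : X ⇒ Y) → Normalises C (m f) f
    m-normalises-f f = proj₁ (proj₂ (m-minimal f))

    m-least : ∀ {X Y} {f g : X ⇒ Y} → PartialChannel C g → Normalises C g f → Normalises C g (m f)
    m-least {f = f} {g} = proj₂ (proj₂ (m-minimal f)) g

    m-fixes-partialChannel : ∀ {X Y} (f : X ⇒ Y) → PartialChannel C f → m f ≡ f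
    m-fixes-partialChannel f f-f = normalises-antisym f-f (m-least f-f f-f) (m-normalises-f f)

    module _
      (m-⊗ : ∀ {X Y Z W} (f : X ⇒ Y) (g : Z ⇒ W) → m (f ⊗₁ g) ≡ m f ⊗₁ m g)
      (m-Δ : ∀ {X Y} (f : (X ⊗₀ X) ⇒ Y) → m (f ∘ Δ) ≡ m f ∘ Δ)
      where
      open Compatible m m-⊗ m-Δ (m-fixes-partialChannel ε ε-partialChannel)

      m-ε∘ : ∀ {X Y} (f : X ⇒ Y) → m (ε ∘ f) ≡ ε ∘ m f
      m-ε∘ f = normalises-antisym discard-partial
        (m-least discard-partial (ε∘-normalises (m-normalises-f f)))
        discard-normalised
        where
        discard-partial : PartialChannel C (ε ∘ m f)
        discard-partial = ε∘-partialChannel (m-partial f)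

        m-f-weighted : m f ≡ m f · m (ε ∘ f)
        m-f-weighted = m-normalises (m-fixes-partialChannel (m f) (m-partial f)) (m-normalises-f f)

        discard-normalised : Normalises C (m (ε ∘ f)) (ε ∘ m f)
        discard-normalised = begin
          ε ∘ m f                        ≡⟨ cong (ε ∘_) m-f-weighted ⟩
          ε ∘ (m f · m (ε ∘ f))          ≡⟨ ε∘-· (m f) (m (ε ∘ f)) ⟩
          (ε ∘ m f) · m (ε ∘ f)          ≡⟨ ·-comm (ε ∘ m f) (m (ε ∘ f)) ⟩
          m (ε ∘ f) · (ε ∘ m f)          ≡⟨ cong (m (ε ∘ f) ·_) (sym (ε∘-scalar (ε ∘ m f))) ⟩
          m (ε ∘ f) · (ε ∘ (ε ∘ m f))    ∎

  compatibleMinimal⇒normalisation : HasCompatibleMinimalNormalisations C → HasNormalisation C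
  compatibleMinimal⇒normalisation (m , m-minimal , m-⊗ , m-Δ) = record
    { norm            = m
    ; norm-partial    = m-partial
    ; norm-normalises = m-normalises-f
    ; N1              = m-fixes-partialChannel
    ; N2              = m-⊗
    ; N3              = m-ε∘ m-⊗ m-Δ
    ; N4              = m-Δ
    }
    where open Minimal m m-minimal

corollaryB7 : ∀ {o ℓ : Level} (C : CDCategory o ℓ) →
    HasNormalisation C ⇔ HasCompatibleMinimalNormalisations C
corollaryB7 C = mk⇔ normalisation⇒compatibleMinimal compatibleMinimal⇒normalisation
  where open Normalisation C
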